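{- Let $P \subseteq \mathbb{Z}^m$ be a rectangle and let $\omega \in \mathbb{Z}_{\geq 0}$. Then $Q_\omega \subseteq_{S,P} Q_{\omega+1}$, where $Q_\omega = \{\mathbf{x} \in \mathbb{Z}^m : \|\mathbf{x}\|_1 \leq \omega\}$.
   Context: $\|\mathbf{x}\|_1 = |x_1| + \cdots + |x_m|$. A rectangle in $\mathbb{Z}^m$ is a set of the form $\mathbb{Z}^m \cap \prod_{i=1}^m [a_i, b_i]$ with integers $a_i \leq b_i$. For a pixel set $P \subseteq \mathbb{Z}^m$ and finite sets $B_1, B_2 \subseteq \mathbb{Z}^m$ containing $\mathbf{0}$, $B_1 \subseteq_{S,P} B_2$ means $B_1 \subseteq B_2$ and both: (+) for every $\mathbf{x} \in P$ and $\mathbf{b}_2 \in B_2$ with $\mathbf{x} + \mathbf{b}_2 \in P$ there is $\mathbf{b}_1 \in B_1$ with $\mathbf{x} + \mathbf{b}_1 \in P$ and $B_1 + (\mathbf{b}_2 - \mathbf{b}_1) \subseteq B_2$; (−) for every $\mathbf{x} \in P$ and $\mathbf{b}_2 \in B_2$ with $\mathbf{x} - \mathbf{b}_2 \in P$ there is $\mathbf{b}_1 \in B_1$ with $\mathbf{x} - \mathbf{b}_1 \in P$ and $B_1 + (\mathbf{b}_2 - \mathbf{b}_1) \subseteq B_2$. Here $A + \mathbf{v} = \{\mathbf{a} + \mathbf{v} : \mathbf{a} \in A\}$. -}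

module Defs where

open import Data.Nat using (ℕ; zero; suc) renaming (_+_ to _N+_; _≤_ to _N≤_)
open import Data.Fin using (Fin) renaming (zero to fzero; suc to fsuc)
open import Data.Integer using (ℤ; +_; _+_; _-_; _≤_; ∣_∣)
open import Data.Product using (Σ; _×_; ∃-syntax)

Point : ℕ → Set
Point m = Fin m → ℤ

PSet : ℕ → Set₁
PSet m = Point m → Set

_⊕_ : ∀ {m} → Point m → Point m → Point m
(x ⊕ y) i = x i + y i

_⊖_ : ∀ {m} → Point m → Point m → Point m
(x ⊖ y) i = x i - y i

norm1 : ∀ {m} → Point m → ℕ
norm1 {zero} x = 0
norm1 {suc m} x = ∣ x fzero ∣ N+ norm1 {m} (λ i → x (fsuc i))


Q : (m : ℕ) → ℕ → PSet m
Q m ω x = norm1 x N≤ ω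


Rect : ∀ {m} → Point m → Point m → PSet m
Rect a b x = ∀ i → (a i ≤ x i) × (x i ≤ b i)

_⊆_ : ∀ {m} → PSet m → PSet m → Set
A ⊆ B = ∀ x → A x → B x

_+v⊆_ : ∀ {m} → PSet m → Point m → PSet m → Set
_+v⊆_ A v B = ∀ a → A a → B (a ⊕ v)

SubS : ∀ {m} → PSet m → PSet m → PSet m → Set
SubS P B₁ B₂ =
  (B₁ ⊆ B₂)
  × (∀ x b₂ → P x → B₂ b₂ → P (x ⊕ b₂) →
       ∃[ b₁ ] (B₁ b₁ × P (x ⊕ b₁) × _+v⊆_ B₁ (b₂ ⊖ b₁) B₂))
  × (∀ x b₂ → P x → B₂ b₂ → P (x ⊖ b₂) →
       ∃[ b₁ ] (B₁ b₁ × P (x ⊖ b₁) × _+v⊆_ B₁ (b₂ ⊖ b₁) B₂))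

-- Shrink b₂ ∈ Q_{ω+1} to b₁ ∈ Q_ω by moving its first nonzero coordinate one step
-- towards 0. Then ‖b₂ − b₁‖₁ ≤ 1, so Q_ω + (b₂ − b₁) ⊆ Q_{ω+1}; and every coordinate of
-- b₁ lies between 0 and the corresponding coordinate of b₂, so x ± b₁ lies coordinatewise
-- between x and x ± b₂, hence in the rectangle whenever both of those are.
module Submission where

open import Defs
open import Data.Nat using (ℕ)
open import Data.Fin using (Fin)
open import Data.Integer using (_≤_)

open import Data.Nat using (zero; suc; pred; _∸_; z≤n) renaming (_+_ to _N+_; _≤_ to _N≤_)
open import Data.Fin using () renaming (zero to fzero; suc to fsuc)
open import Data.Integer using (ℤ; +_; -[1+_]; +[1+_]; +≤+; _+_; _-_; -_; ∣_∣)
open import Data.Vec.Functional using (_∷_; tail)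
import Data.Nat.Properties as NP
import Data.Integer.Properties as ZP
open import Algebra.Properties.CommutativeSemigroup NP.+-commutativeSemigroup using (interchange)
open import Data.Product using (_×_; _,_)
open import Data.Sum using (_⊎_; inj₁; inj₂)
open import Relation.Binary.PropositionalEquality

infix 4 _⊑_

_⊑_ : ℤ → ℤ → Set
s ⊑ b = (+ 0 ≤ s × s ≤ b) ⊎ (b ≤ s × s ≤ + 0)

⊑-refl : ∀ b → b ⊑ b
⊑-refl (+ n)    = inj₁ (+≤+ z≤n , ZP.≤-refl)
⊑-refl -[1+ n ] = inj₂ (ZP.≤-refl , ZP.neg-≤-pos)

⊑-neg : ∀ {s b} → s ⊑ b → - s ⊑ - b
⊑-neg (inj₁ (0≤s , s≤b)) = inj₂ (ZP.neg-mono-≤ s≤b , ZP.neg-mono-≤ 0≤s)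
⊑-neg (inj₂ (b≤s , s≤0)) = inj₁ (ZP.neg-mono-≤ s≤0 , ZP.neg-mono-≤ b≤s)

+-⊑-∈interval : ∀ {lo hi x v s} → lo ≤ x → x ≤ hi → lo ≤ x + v → x + v ≤ hi →
  s ⊑ v → lo ≤ x + s × x + s ≤ hi
+-⊑-∈interval {x = x} lo≤x x≤hi lo≤x+v x+v≤hi (inj₁ (0≤s , s≤v)) =
  ZP.≤-trans lo≤x (ZP.≤-trans (ZP.≤-reflexive (sym (ZP.+-identityʳ x))) (ZP.+-monoʳ-≤ x 0≤s)) ,
  ZP.≤-trans (ZP.+-monoʳ-≤ x s≤v) x+v≤hi
+-⊑-∈interval {x = x} lo≤x x≤hi lo≤x+v x+v≤hi (inj₂ (v≤s , s≤0)) =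
  ZP.≤-trans lo≤x+v (ZP.+-monoʳ-≤ x v≤s) ,
  ZP.≤-trans (ZP.≤-trans (ZP.+-monoʳ-≤ x s≤0) (ZP.≤-reflexive (ZP.+-identityʳ x))) x≤hi

∣-∣-split-nonneg : ∀ {s b} → + 0 ≤ s → s ≤ b → ∣ b - s ∣ N+ ∣ s ∣ ≡ ∣ b ∣
∣-∣-split-nonneg {+ k} {+ n} _ (+≤+ k≤n) = begin
  ∣ + n - + k ∣ N+ k     ≡⟨ cong (λ d → ∣ d ∣ N+ k) (trans (ZP.m-n≡m⊖n n k) (ZP.⊖-≥ k≤n)) ⟩
  (n ∸ k) N+ k           ≡⟨ NP.m∸n+n≡m k≤n ⟩
  n                      ∎
  where open ≡-Reasoning

⊑⇒∣-∣-split : ∀ {s b} → s ⊑ b → ∣ b - s ∣ N+ ∣ s ∣ ≡ ∣ b ∣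
⊑⇒∣-∣-split (inj₁ (0≤s , s≤b)) = ∣-∣-split-nonneg 0≤s s≤b
⊑⇒∣-∣-split {s} {b} (inj₂ (b≤s , s≤0)) = begin
  ∣ b - s ∣ N+ ∣ s ∣          ≡⟨ cong₂ _N+_ ∣b-s∣≡∣[-b]-[-s]∣ (sym (ZP.∣-i∣≡∣i∣ s)) ⟩
  ∣ - b - - s ∣ N+ ∣ - s ∣    ≡⟨ ∣-∣-split-nonneg (ZP.neg-mono-≤ s≤0) (ZP.neg-mono-≤ b≤s) ⟩
  ∣ - b ∣                     ≡⟨ ZP.∣-i∣≡∣i∣ b ⟩
  ∣ b ∣                       ∎
  where
  open ≡-Reasoning
  ∣b-s∣≡∣[-b]-[-s]∣ : ∣ b - s ∣ ≡ ∣ - b - - s ∣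
  ∣b-s∣≡∣[-b]-[-s]∣ = trans (sym (ZP.∣-i∣≡∣i∣ (b - s))) (cong ∣_∣ (ZP.neg-distrib-+ b (- s)))

stepToZero : ℤ → ℤ
stepToZero (+ n)    = + pred n
stepToZero -[1+ n ] = - + n

stepToZero-⊑ : ∀ z → stepToZero z ⊑ z
stepToZero-⊑ (+ n)    = inj₁ (+≤+ z≤n , +≤+ NP.pred[n]≤n)
stepToZero-⊑ -[1+ n ] = inj₂ (ZP.neg-mono-≤ (+≤+ (NP.n≤1+n n)) , ZP.neg-mono-≤ (+≤+ z≤n))

mutual
  shrink : ∀ {m} → Point m → Point m
  shrink {zero}  x = x
  shrink {suc m} x = shrinkCons (x fzero) (tail x)

  shrinkCons : ∀ {m} → ℤ → Point m → Point (suc m)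
  shrinkCons (+ 0) t = + 0 ∷ shrink t
  shrinkCons z     t = stepToZero z ∷ t

mutual
  norm1-shrink : ∀ {m} (x : Point m) → norm1 (shrink x) ≡ pred (norm1 x)
  norm1-shrink {zero}  x = refl
  norm1-shrink {suc m} x = norm1-shrinkCons (x fzero) (tail x)

  norm1-shrinkCons : ∀ {m} z (t : Point m) → norm1 (shrinkCons z t) ≡ pred (∣ z ∣ N+ norm1 t)
  norm1-shrinkCons (+ 0)    t = norm1-shrink t
  norm1-shrinkCons +[1+ n ] t = refl
  norm1-shrinkCons -[1+ n ] t = cong (_N+ norm1 t) (ZP.∣-i∣≡∣i∣ (+ n))

mutual
  shrink-⊑ : ∀ {m} (x : Point m) i → shrink x i ⊑ x i
  shrink-⊑ {suc m} x fzero    = shrinkCons-⊑ (x fzero) (tail x) fzero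
  shrink-⊑ {suc m} x (fsuc i) = shrinkCons-⊑ (x fzero) (tail x) (fsuc i)

  shrinkCons-⊑ : ∀ {m} z (t : Point m) i → shrinkCons z t i ⊑ (z ∷ t) i
  shrinkCons-⊑ (+ 0)          t fzero    = ⊑-refl (+ 0)
  shrinkCons-⊑ (+ 0)          t (fsuc i) = shrink-⊑ t i
  shrinkCons-⊑ z@(+[1+ _ ])   t fzero    = stepToZero-⊑ z
  shrinkCons-⊑ +[1+ _ ]       t (fsuc i) = ⊑-refl (t i)
  shrinkCons-⊑ z@(-[1+ _ ])   t fzero    = stepToZero-⊑ z
  shrinkCons-⊑ -[1+ _ ]       t (fsuc i) = ⊑-refl (t i)

norm1-triangle : ∀ {m} (x y : Point m) → norm1 (x ⊕ y) N≤ norm1 x N+ norm1 y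
norm1-triangle {zero}  x y = z≤n
norm1-triangle {suc m} x y = NP.≤-trans
  (NP.+-mono-≤ (ZP.∣i+j∣≤∣i∣+∣j∣ (x fzero) (y fzero)) (norm1-triangle (tail x) (tail y)))
  (NP.≤-reflexive (interchange (∣ x fzero ∣) (∣ y fzero ∣) (norm1 (tail x)) (norm1 (tail y))))

norm1-+-pointwise : ∀ {m} (u v w : Point m) → (∀ i → ∣ u i ∣ N+ ∣ v i ∣ ≡ ∣ w i ∣) →
  norm1 u N+ norm1 v ≡ norm1 w
norm1-+-pointwise {zero}  u v w eq = refl
norm1-+-pointwise {suc m} u v w eq = trans
  (interchange (∣ u fzero ∣) (norm1 (tail u)) (∣ v fzero ∣) (norm1 (tail v)))
  (cong₂ _N+_ (eq fzero) (norm1-+-pointwise (tail u) (tail v) (tail w) (λ i → eq (fsuc i))))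

d+pred[n]≡n⇒d≤1 : ∀ d n → d N+ pred n ≡ n → d N≤ 1
d+pred[n]≡n⇒d≤1 d zero    eq = NP.≤-trans (NP.≤-reflexive (NP.m+n≡0⇒m≡0 d eq)) z≤n
d+pred[n]≡n⇒d≤1 d (suc n) eq = NP.≤-reflexive (NP.+-cancelʳ-≡ n d 1 eq)

norm1-⊖-shrink : ∀ {m} (x : Point m) → norm1 (x ⊖ shrink x) N≤ 1
norm1-⊖-shrink x = d+pred[n]≡n⇒d≤1 (norm1 (x ⊖ shrink x)) (norm1 x) (begin
  norm1 (x ⊖ shrink x) N+ pred (norm1 x)     ≡⟨ cong (norm1 (x ⊖ shrink x) N+_) (sym (norm1-shrink x)) ⟩
  norm1 (x ⊖ shrink x) N+ norm1 (shrink x)   ≡⟨ norm1-+-pointwise _ _ x (λ i → ⊑⇒∣-∣-split (shrink-⊑ x i)) ⟩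
  norm1 x                                    ∎)
  where open ≡-Reasoning

Q-⊕ : ∀ {m j k} (x y : Point m) → Q m j x → Q m k y → Q m (j N+ k) (x ⊕ y)
Q-⊕ x y qx qy = NP.≤-trans (norm1-triangle x y) (NP.+-mono-≤ qx qy)

shrink-Q : ∀ {m ω} (x : Point m) → Q m (suc ω) x → Q m ω (shrink x)
shrink-Q x qx = subst (_N≤ _) (sym (norm1-shrink x)) (NP.pred-mono-≤ qx)

Rect-⊕-⊑ : ∀ {m} {lo hi x v s : Point m} → Rect lo hi x → Rect lo hi (x ⊕ v) →
  (∀ i → s i ⊑ v i) → Rect lo hi (x ⊕ s)
Rect-⊕-⊑ px pxv s⊑v i with px i | pxv i
... | lo≤x , x≤hi | lo≤x+v , x+v≤hi = +-⊑-∈interval lo≤x x≤hi lo≤x+v x+v≤hi (s⊑v i)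

Rect-SubS : ∀ {m} {lo hi : Point m} {B₁ B₂ : PSet m} (f : Point m → Point m) →
  B₁ ⊆ B₂ → (∀ b → B₂ b → B₁ (f b)) → (∀ b i → f b i ⊑ b i) →
  (∀ b → B₂ b → _+v⊆_ B₁ (b ⊖ f b) B₂) → SubS (Rect lo hi) B₁ B₂
Rect-SubS f B₁⊆B₂ f∈B₁ f⊑ shift =
  B₁⊆B₂ ,
  (λ x b px b∈B₂ px+b → f b , f∈B₁ b b∈B₂ , Rect-⊕-⊑ px px+b (f⊑ b) , shift b b∈B₂) ,
  (λ x b px b∈B₂ px-b → f b , f∈B₁ b b∈B₂ ,
     -- x ⊖ b unfolds to x ⊕ (λ i → - b i)
     Rect-⊕-⊑ {v = λ i → - b i} px px-b (λ i → ⊑-neg (f⊑ b i)) , shift b b∈B₂)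

theorem2 : (m : ℕ) (a b : Point m) → (∀ i → a i ≤ b i) → (ω : ℕ) →
    SubS (Rect a b) (Q m ω) (Q m (ℕ.suc ω))
theorem2 m a b _ ω = Rect-SubS shrink (λ _ → NP.m≤n⇒m≤1+n) shrink-Q shrink-⊑
  (λ y _ x qx → subst (λ k → Q m k (x ⊕ (y ⊖ shrink y))) (NP.+-comm ω 1)
     (Q-⊕ x (y ⊖ shrink y) qx (norm1-⊖-shrink y)))
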